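{- Let $\Gamma$ be a finite sequence of implicational Horn formulas, $\phi$ a monotone formula, and $q,r$ atoms. If the sequent $\Gamma,\phi\Rightarrow q\vee r$ is valid, then there are monotone circuits $C$ and $D$ in the variables of $\phi$, of size $(|\Gamma|+|\phi|)^{O(1)}$, such that the sequents $\Gamma,\phi\Rightarrow[C]\vee[D]$, $\Gamma,[C]\Rightarrow q$ and $\Gamma,[D]\Rightarrow r$ are all valid.
   Context: Formulas are over $\{\top,\bot,\wedge,\vee,\to\}$; monotone formulas contain no implication; monotone circuits use only gates $\top,\bot,\wedge,\vee$ and $[C]$ is the formula obtained by unfolding circuit $C$. An implicational Horn formula is an atom or of the form $\bigwedge_{i=1}^k p_i\to r$ with $p_i,r$ atoms. A sequent $\Gamma\Rightarrow\Delta$ is valid if $\bigwedge\Gamma\to\bigvee\Delta$ is a classical tautology. -}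

module Defs where

open import Data.Nat using (ℕ; zero; suc; _+_)
open import Data.Bool using (Bool; true; false; _∧_; _∨_; not)
open import Data.Fin using (Fin; zero; suc)
open import Data.List using (List; []; _∷_; map; foldr; length)
open import Data.Nat.ListAction using (sum)
open import Data.List.NonEmpty using (List⁺; _∷_)
open import Data.List.Membership.Propositional using (_∈_)
open import Data.Unit using (⊤)
open import Data.Product using (_×_)
open import Relation.Binary.PropositionalEquality using (_≡_)

Atom : Set
Atom = ℕ

data Fm : Set where
  atom : Atom → Fm
  tt ff : Fm
  _&_ _∣∣_ _⇒_ : Fm → Fm → Fm

infixr 6 _&_
infixr 5 _∣∣_
infixr 4 _⇒_

size : Fm → ℕ
size (atom _) = 1
size tt = 1
size ff = 1
size (φ & ψ) = suc (size φ + size ψ)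
size (φ ∣∣ ψ) = suc (size φ + size ψ)
size (φ ⇒ ψ) = suc (size φ + size ψ)

sizeL : List Fm → ℕ
sizeL Γ = sum (map size Γ)

atoms : Fm → List Atom
atoms (atom p) = p ∷ []
atoms tt = []
atoms ff = []
atoms (φ & ψ) = atoms φ Data.List.++ atoms ψ
atoms (φ ∣∣ ψ) = atoms φ Data.List.++ atoms ψ
atoms (φ ⇒ ψ) = atoms φ Data.List.++ atoms ψ

data Monotone : Fm → Set where
  atom : ∀ p → Monotone (atom p)
  tt : Monotone tt
  ff : Monotone ff
  _&_ : ∀ {φ ψ} → Monotone φ → Monotone ψ → Monotone (φ & ψ)
  _∣∣_ : ∀ {φ ψ} → Monotone φ → Monotone ψ → Monotone (φ ∣∣ ψ)

conjAux : Atom → List Atom → Fm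
conjAux p [] = atom p
conjAux p (q ∷ qs) = atom p & conjAux q qs

conjAtoms : List⁺ Atom → Fm
conjAtoms (p ∷ ps) = conjAux p ps

data Horn : Fm → Set where
  atom : ∀ p → Horn (atom p)
  imp  : ∀ ps r → Horn (conjAtoms ps ⇒ atom r)

eval : (Atom → Bool) → Fm → Bool
eval v (atom p) = v p
eval v tt = true
eval v ff = false
eval v (φ & ψ) = eval v φ ∧ eval v ψ
eval v (φ ∣∣ ψ) = eval v φ ∨ eval v ψ
eval v (φ ⇒ ψ) = not (eval v φ) ∨ eval v ψ

bigAnd : List Fm → Fm
bigAnd [] = tt
bigAnd (φ ∷ Γ) = φ & bigAnd Γ

bigOr : List Fm → Fm
bigOr [] = ff
bigOr (φ ∷ Δ) = φ ∣∣ bigOr Δ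

Valid : List Fm → List Fm → Set
Valid Γ Δ = ∀ (v : Atom → Bool) → eval v (bigAnd Γ ⇒ bigOr Δ) ≡ true

-- Monotone circuits: a sequence of gates, each referring to earlier gates.
-- In Gate n, a reference (i : Fin n) points to one of the n earlier gates,
-- zero = the most recent one.
data Gate (n : ℕ) : Set where
  input : Atom → Gate n
  top bot : Gate n
  and or : Fin n → Fin n → Gate n

data Circ : ℕ → Set where
  nil  : Circ 0
  snoc : ∀ {n} → Circ n → Gate n → Circ (suc n)

-- A monotone circuit with an output: a nonempty gate sequence; the output
-- is the last gate.  Its size is the number of gates.
record Circuit : Set where
  constructor circuit
  field
    {gates} : ℕ
    body    : Circ (suc gates)

circSize : Circuit → ℕ
circSize (circuit {n} _) = suc n

mutual
  node : ∀ {n} → Circ n → Fin n → Fm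
  node (snoc C g) zero = gateFm C g
  node (snoc C g) (suc i) = node C i

  gateFm : ∀ {n} → Circ n → Gate n → Fm
  gateFm C (input p) = atom p
  gateFm C top = tt
  gateFm C bot = ff
  gateFm C (and i j) = node C i & node C j
  gateFm C (or i j) = node C i ∣∣ node C j

⟦_⟧ : Circuit → Fm
⟦ circuit C ⟧ = node C zero

InputsIn : ∀ {n} → List Atom → Circ n → Set
InputsIn xs nil = ⊤
InputsIn xs (snoc C (input p)) = (p ∈ xs) × InputsIn xs C
InputsIn xs (snoc C _) = InputsIn xs C

CircuitIn : Fm → Circuit → Set
CircuitIn φ (circuit C) = InputsIn (atoms φ) C

{-# OPTIONS --safe #-}
-- The clauses of the Horn sequence Γ have, above every valuation u, a least model, reached by
-- forward chaining: a sweep through the clauses starting from a valuation that is not closed makes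
-- one more clause head true, so |Γ| + 1 sweeps suffice, and every sweep is a monotone circuit of size
-- O(|Γ|) built on top of the previous one.  Let C and D compute q and r in the least model above
-- v restricted to the variables of φ.  If v satisfies Γ, that least model lies below v, whence
-- Γ, [C] ⇒ q and Γ, [D] ⇒ r.  If v satisfies φ, the least model satisfies φ by monotonicity and
-- Γ by construction, so by hypothesis it makes q or r true, that is, [C] or [D] holds at v.
module Submission where

open import Defs
open import Data.Nat using (ℕ; zero; suc; _+_; _*_; _^_; _≤_; _<_; _≟_; z≤n; s≤s)
open import Data.Nat.Properties
open import Data.Nat.GeneralisedArithmetic using (fold)
open import Data.Nat.ListAction using (sum)
open import Data.Nat.Tactic.RingSolver using (solve-∀)
open import Data.Bool using (Bool; true; false; _∧_; _∨_; not; T; T?)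
open import Data.Bool.Properties using (T-≡; T-∧; T-∨; ∧-identityʳ; ∨-idem)
open import Data.Bool.ListAction using (all; any)
open import Data.Fin using (Fin; zero; suc)
open import Data.List using (List; []; _∷_; map; length; _++_; foldl)
open import Data.List.NonEmpty using (_∷_; toList)
open import Data.List.Properties using (length-++; length-map)
open import Data.List.Membership.Propositional using (_∈_; find)
open import Data.List.Membership.Propositional.Properties using (∈-++⁺ˡ; ∈-++⁺ʳ; ∈-map⁺)
open import Data.List.Relation.Binary.Subset.Propositional using (_⊆_)
open import Data.List.Relation.Unary.All as All using (All; []; _∷_; all?)
open import Data.List.Relation.Unary.All.Properties using (all⁺; all⁻; ¬All⇒Any¬)
open import Data.List.Relation.Unary.Any as Any using (Any; here; there)
open import Data.List.Relation.Unary.Any.Properties using (any⁺; any⁻; map⁺; map⁻)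
open import Data.Product using (Σ; _×_; _,_; proj₁; proj₂)
open import Data.Sum using (_⊎_; inj₁; inj₂; [_,_])
open import Data.Empty using (⊥-elim)
open import Function using (_∘_; id; const; _⇔_; mk⇔; Equivalence)
open import Relation.Nullary using (¬_; Dec; yes; no; _→-dec_)
open import Relation.Binary.PropositionalEquality using (_≡_; refl; sym; trans; cong; cong₂; subst; _≗_; module ≡-Reasoning)

open Equivalence using (to; from)

Valuation : Set
Valuation = Atom → Bool

_⊑_ : Valuation → Valuation → Set
u ⊑ w = ∀ {x} → T (u x) → T (w x)

T-⇒ : ∀ {a b} → T (not a ∨ b) ⇔ (T a → T b)
T-⇒ {true} = mk⇔ const (λ f → f _)
T-⇒ {false} = mk⇔ (λ _ ()) (const _)

eval-bigAnd : ∀ v Γ → eval v (bigAnd Γ) ≡ all (eval v) Γ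
eval-bigAnd v [] = refl
eval-bigAnd v (φ ∷ Γ) = cong (eval v φ ∧_) (eval-bigAnd v Γ)

eval-bigOr : ∀ v Δ → eval v (bigOr Δ) ≡ any (eval v) Δ
eval-bigOr v [] = refl
eval-bigOr v (φ ∷ Δ) = cong (eval v φ ∨_) (eval-bigOr v Δ)

valid⁺ : ∀ {Γ Δ} → (∀ v → All (T ∘ eval v) Γ → Any (T ∘ eval v) Δ) → Valid Γ Δ
valid⁺ {Γ} {Δ} entails v rewrite eval-bigAnd v Γ | eval-bigOr v Δ =
  to T-≡ (from T-⇒ (any⁺ (eval v) ∘ entails v ∘ all⁺ (eval v) Γ))

valid⁻ : ∀ {Γ Δ} → Valid Γ Δ → ∀ v → All (T ∘ eval v) Γ → Any (T ∘ eval v) Δ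
valid⁻ {Γ} {Δ} valid v with valid v
... | holds rewrite eval-bigAnd v Γ | eval-bigOr v Δ =
  any⁻ (eval v) Δ ∘ to T-⇒ (from T-≡ holds) ∘ all⁻ (eval v)

eval-mono : ∀ {φ v w} → Monotone φ → (∀ {x} → x ∈ atoms φ → T (v x) → T (w x)) →
  T (eval v φ) → T (eval w φ)
eval-mono (atom p) v⊑w = v⊑w (here refl)
eval-mono tt v⊑w _ = _
eval-mono (_&_ {φ} mφ mψ) v⊑w t =
  let tφ , tψ = to T-∧ t
  in from T-∧ (eval-mono mφ (v⊑w ∘ ∈-++⁺ˡ) tφ , eval-mono mψ (v⊑w ∘ ∈-++⁺ʳ (atoms φ)) tψ)
eval-mono (_∣∣_ {φ} mφ mψ) v⊑w t with to T-∨ t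
... | inj₁ tφ = from T-∨ (inj₁ (eval-mono mφ (v⊑w ∘ ∈-++⁺ˡ) tφ))
... | inj₂ tψ = from T-∨ (inj₂ (eval-mono mψ (v⊑w ∘ ∈-++⁺ʳ (atoms φ)) tψ))

_[_↦_] : {A : Set} → (Atom → A) → Atom → A → Atom → A
(f [ h ↦ a ]) x with x ≟ h
... | yes _ = a
... | no _ = f x

restrict : Valuation → List Atom → Valuation
restrict v [] _ = false
restrict v (p ∷ ps) = restrict v ps [ p ↦ v p ]

restrict-⊑ : ∀ v ps → restrict v ps ⊑ v
restrict-⊑ v [] ()
restrict-⊑ v (p ∷ ps) {x} t with x ≟ p
... | yes refl = t
... | no _ = restrict-⊑ v ps t

restrict-∈ : ∀ {v ps x} → x ∈ ps → T (v x) → T (restrict v ps x)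
restrict-∈ {v} {p ∷ ps} {x} x∈ t with x ≟ p | x∈
... | yes refl | _ = t
... | no _ | there x∈ps = restrict-∈ x∈ps t
... | no x≢p | here x≡p = ⊥-elim (x≢p x≡p)

Clause : Set
Clause = List Atom × Atom

Sat : Valuation → Clause → Set
Sat u (body , head) = T (all u body) → T (u head)

sat? : ∀ u c → Dec (Sat u c)
sat? u (body , head) = T? (all u body) →-dec T? (u head)

Closed : List Clause → Valuation → Set
Closed K u = All (Sat u) K

clause : ∀ {φ} → Horn φ → Clause
clause (atom p) = [] , p
clause (imp ps r) = toList ps , r

clauses : ∀ {Γ} → All Horn Γ → List Clause
clauses = All.reduce clause

eval-conjAux : ∀ v p ps → eval v (conjAux p ps) ≡ all v (p ∷ ps)
eval-conjAux v p [] = sym (∧-identityʳ (v p))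
eval-conjAux v p (q ∷ qs) = cong (v p ∧_) (eval-conjAux v q qs)

T-eval-horn : ∀ {φ v} (hφ : Horn φ) → T (eval v φ) ⇔ Sat v (clause hφ)
T-eval-horn (atom p) = mk⇔ const (λ f → f _)
T-eval-horn {v = v} (imp (p ∷ ps) r) rewrite eval-conjAux v p ps = T-⇒

models⇒closed : ∀ {Γ v} (hs : All Horn Γ) → All (T ∘ eval v) Γ → Closed (clauses hs) v
models⇒closed [] [] = []
models⇒closed (hφ ∷ hs) (t ∷ ts) = to (T-eval-horn hφ) t ∷ models⇒closed hs ts

closed⇒models : ∀ {Γ v} (hs : All Horn Γ) → Closed (clauses hs) v → All (T ∘ eval v) Γ
closed⇒models [] [] = []
closed⇒models (hφ ∷ hs) (s ∷ ss) = from (T-eval-horn hφ) s ∷ closed⇒models hs ss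

all-mono : ∀ {u w} → u ⊑ w → ∀ xs → T (all u xs) → T (all w xs)
all-mono u⊑w xs = all⁻ _ ∘ All.map u⊑w ∘ all⁺ _ xs

Sat-transfer : ∀ {u w c} → u ⊑ w → w ⊑ u → Sat u c → Sat w c
Sat-transfer {c = body , _} u⊑w w⊑u sat = u⊑w ∘ sat ∘ all-mono w⊑u body

¬Sat : ∀ {u c} → ¬ Sat u c → T (all u (proj₁ c)) × ¬ T (u (proj₂ c))
¬Sat {u} {body , head} ¬sat with all u body | u head
... | true | false = _ , id
... | true | true = ⊥-elim (¬sat _)
... | false | _ = ⊥-elim (¬sat λ ())

fire : Valuation → Clause → Valuation
fire u (body , head) = u [ head ↦ u head ∨ all u body ]

fire-extensive : ∀ u c → u ⊑ fire u c
fire-extensive u (body , head) {x} t with x ≟ head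
... | yes refl = from T-∨ (inj₁ t)
... | no _ = t

fire-least : ∀ {u w c} → Sat w c → u ⊑ w → fire u c ⊑ w
fire-least {c = body , head} sat u⊑w {x} t with x ≟ head
... | yes refl = [ u⊑w , sat ∘ all-mono u⊑w body ] (to T-∨ t)
... | no _ = u⊑w t

fire-head : ∀ u body head → T (all u body) → T (fire u (body , head) head)
fire-head u body head t with head ≟ head
... | yes _ = from T-∨ (inj₂ t)
... | no head≢head = ⊥-elim (head≢head refl)

sweep : List Clause → Valuation → Valuation
sweep cs u = foldl fire u cs

sweep-extensive : ∀ cs u → u ⊑ sweep cs u
sweep-extensive [] u = id
sweep-extensive (c ∷ cs) u = sweep-extensive cs (fire u c) ∘ fire-extensive u c

sweep-least : ∀ {cs u w} → All (Sat w) cs → u ⊑ w → sweep cs u ⊑ w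
sweep-least [] u⊑w = u⊑w
sweep-least {c ∷ _} (sat ∷ sats) u⊑w = sweep-least sats (fire-least {c = c} sat u⊑w)

sweep-head : ∀ {cs body head} u → (body , head) ∈ cs → T (all u body) → T (sweep cs u head)
sweep-head {c ∷ cs} {body} {head} u (here refl) t = sweep-extensive cs (fire u c) (fire-head u body head t)
sweep-head {c ∷ cs} {body} u (there c∈cs) t = sweep-head (fire u c) c∈cs (all-mono (fire-extensive u c) body t)

sweep-closed : ∀ {K w} → Closed K w → Closed K (sweep K w)
sweep-closed {K} {w} closed = All.map (λ {c} → Sat-transfer {c = c} (sweep-extensive K w) (sweep-least closed id)) closed

indicator : Bool → ℕ
indicator true = 1
indicator false = 0

#true : Valuation → List Atom → ℕ
#true u [] = 0
#true u (x ∷ xs) = indicator (u x) + #true u xs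

#true≤length : ∀ u xs → #true u xs ≤ length xs
#true≤length u [] = z≤n
#true≤length u (x ∷ xs) = +-mono-≤ (indicator≤1 (u x)) (#true≤length u xs)
  where
  indicator≤1 : ∀ b → indicator b ≤ 1
  indicator≤1 true = ≤-refl
  indicator≤1 false = z≤n

indicator-mono : ∀ {a b} → (T a → T b) → indicator a ≤ indicator b
indicator-mono {false} _ = z≤n
indicator-mono {true} {true} _ = ≤-refl
indicator-mono {true} {false} a⇒b = ⊥-elim (a⇒b _)

#true-mono : ∀ {u w} → u ⊑ w → ∀ xs → #true u xs ≤ #true w xs
#true-mono u⊑w [] = z≤n
#true-mono u⊑w (x ∷ xs) = +-mono-≤ (indicator-mono u⊑w) (#true-mono u⊑w xs)

#true-mono-< : ∀ {u w x xs} → u ⊑ w → x ∈ xs → ¬ T (u x) → T (w x) → #true u xs < #true w xs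
#true-mono-< {u} {w} {x} {_ ∷ xs} u⊑w (here refl) ¬ux wx with u x | w x
... | false | true = s≤s (#true-mono u⊑w xs)
... | true | _ = ⊥-elim (¬ux _)
#true-mono-< {xs = _ ∷ _} u⊑w (there x∈xs) ¬ux wx =
  +-mono-≤-< (indicator-mono u⊑w) (#true-mono-< u⊑w x∈xs ¬ux wx)

-- A circuit being built, with `wire x` the gate currently computing atom x.
record Net (xs : List Atom) : Set where
  constructor net
  field
    {n}    : ℕ
    gates  : Circ (suc n)
    wire   : Atom → Fin (suc n)
    inputs : InputsIn xs gates
open Net using (gates; wire; inputs)

value : ∀ {xs} → Valuation → Net xs → Valuation
value v s x = eval v (node (gates s) (wire s x))

output : ∀ {xs} → Net xs → Fm
output s = node (gates s) zero

andAll : ∀ {xs} → Net xs → List Atom → Net xs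
andAll s [] = net (snoc (gates s) top) (suc ∘ wire s) (inputs s)
andAll s (p ∷ ps) =
  let s′ = andAll s ps in net (snoc (gates s′) (and (wire s′ p) zero)) (suc ∘ wire s′) (inputs s′)

fireNet : ∀ {xs} → Net xs → Clause → Net xs
fireNet s (body , head) =
  let s′ = andAll s body in
  net (snoc (gates s′) (or (wire s′ head) zero)) ((suc ∘ wire s′) [ head ↦ zero ]) (inputs s′)

sweepNet : ∀ {xs} → List Clause → Net xs → Net xs
sweepNet cs s = foldl fireNet s cs

inputNet : ∀ {xs} ps → ps ⊆ xs → Net xs
inputNet [] _ = net (snoc nil bot) (const zero) _
inputNet (p ∷ ps) ps⊆xs =
  let s = inputNet ps (ps⊆xs ∘ there) in
  net (snoc (gates s) (input p)) ((suc ∘ wire s) [ p ↦ zero ]) (ps⊆xs (here refl) , inputs s)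

-- The output of a circuit is its last gate, so the gate of a is copied to the end.
readout : ∀ {xs} → Net xs → Atom → Circuit
readout s a = circuit (snoc (gates s) (or (wire s a) (wire s a)))

module _ {xs : List Atom} (v : Valuation) where

  value-andAll : ∀ {s : Net xs} {u} → value v s ≗ u → ∀ ps → value v (andAll s ps) ≗ u
  value-andAll s≗u [] = s≗u
  value-andAll s≗u (p ∷ ps) = value-andAll s≗u ps

  eval-output-andAll : ∀ {s : Net xs} {u} → value v s ≗ u → ∀ ps → eval v (output (andAll s ps)) ≡ all u ps
  eval-output-andAll s≗u [] = refl
  eval-output-andAll s≗u (p ∷ ps) = cong₂ _∧_ (value-andAll s≗u ps p) (eval-output-andAll s≗u ps)

  value-fireNet : ∀ {s : Net xs} {u} → value v s ≗ u → ∀ c → value v (fireNet s c) ≗ fire u c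
  value-fireNet s≗u (body , head) x with x ≟ head
  ... | yes refl = cong₂ _∨_ (value-andAll s≗u body x) (eval-output-andAll s≗u body)
  ... | no _ = value-andAll s≗u body x

  value-sweepNet : ∀ {s : Net xs} {u} → value v s ≗ u → ∀ cs → value v (sweepNet cs s) ≗ sweep cs u
  value-sweepNet s≗u [] = s≗u
  value-sweepNet s≗u (c ∷ cs) = value-sweepNet (value-fireNet s≗u c) cs

  value-inputNet : ∀ ps (ps⊆xs : ps ⊆ xs) → value v (inputNet ps ps⊆xs) ≗ restrict v ps
  value-inputNet [] _ _ = refl
  value-inputNet (p ∷ ps) ps⊆xs x with x ≟ p
  ... | yes refl = refl
  ... | no _ = value-inputNet ps (ps⊆xs ∘ there) x

eval-readout : ∀ {xs} v (s : Net xs) a → eval v ⟦ readout s a ⟧ ≡ value v s a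
eval-readout v s a = ∨-idem (value v s a)

cost : Clause → ℕ
cost (body , _) = 2 + length body

n-andAll : ∀ {xs} (s : Net xs) ps → Net.n (andAll s ps) ≡ Net.n s + suc (length ps)
n-andAll s [] = sym (+-comm (Net.n s) 1)
n-andAll s (p ∷ ps) = trans (cong suc (n-andAll s ps)) (sym (+-suc (Net.n s) _))

n-fireNet : ∀ {xs} (s : Net xs) c → Net.n (fireNet s c) ≡ Net.n s + cost c
n-fireNet s (body , _) = trans (cong suc (n-andAll s body)) (sym (+-suc (Net.n s) _))

n-sweepNet : ∀ {xs} (s : Net xs) cs → Net.n (sweepNet cs s) ≡ Net.n s + sum (map cost cs)
n-sweepNet s [] = sym (+-identityʳ (Net.n s))
n-sweepNet s (c ∷ cs) = begin
  Net.n (sweepNet cs (fireNet s c))        ≡⟨ n-sweepNet (fireNet s c) cs ⟩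
  Net.n (fireNet s c) + sum (map cost cs)  ≡⟨ cong (_+ sum (map cost cs)) (n-fireNet s c) ⟩
  Net.n s + cost c + sum (map cost cs)     ≡⟨ +-assoc (Net.n s) (cost c) _ ⟩
  Net.n s + sum (map cost (c ∷ cs))        ∎
  where open ≡-Reasoning

n-inputNet : ∀ {xs} ps (ps⊆xs : ps ⊆ xs) → Net.n (inputNet ps ps⊆xs) ≡ length ps
n-inputNet [] _ = refl
n-inputNet (p ∷ ps) ps⊆xs = cong suc (n-inputNet ps (ps⊆xs ∘ there))

module ForwardChaining (K : List Clause) where

  heads : List Atom
  heads = map proj₂ K

  sweep-progress : ∀ {w} → ¬ Closed K w → #true w heads < #true (sweep K w) heads
  sweep-progress {w} ¬closed =
    let c , c∈K , ¬sat = find (¬All⇒Any¬ (sat? w) K ¬closed)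
        t , ¬wh = ¬Sat {c = c} ¬sat
    in #true-mono-< (sweep-extensive K w) (∈-map⁺ proj₂ c∈K) ¬wh (sweep-head w c∈K t)

  rounds : ℕ → Valuation → Valuation
  rounds t u = fold u (sweep K) t

  rounds-extensive : ∀ t u → u ⊑ rounds t u
  rounds-extensive zero u = id
  rounds-extensive (suc t) u = sweep-extensive K _ ∘ rounds-extensive t u

  rounds-least : ∀ {u w} t → Closed K w → u ⊑ w → rounds t u ⊑ w
  rounds-least zero closed u⊑w = u⊑w
  rounds-least (suc t) closed u⊑w = sweep-least closed (rounds-least t closed u⊑w)

  rounds-progress : ∀ t u → Closed K (rounds t u) ⊎ t ≤ #true (rounds t u) heads
  rounds-progress zero u = inj₂ z≤n
  rounds-progress (suc t) u with rounds-progress t u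
  ... | inj₁ closed = inj₁ (sweep-closed closed)
  ... | inj₂ t≤ with all? (sat? (rounds t u)) K
  ...   | yes closed = inj₁ (sweep-closed closed)
  ...   | no ¬closed = inj₂ (≤-trans (s≤s t≤) (sweep-progress ¬closed))

  closure : Valuation → Valuation
  closure = rounds (suc (length K))

  closure-closed : ∀ u → Closed K (closure u)
  closure-closed u with rounds-progress (suc (length K)) u
  ... | inj₁ closed = closed
  ... | inj₂ K<#true = ⊥-elim (<-irrefl refl (begin-strict
    length K              <⟨ K<#true ⟩
    #true (closure u) heads ≤⟨ #true≤length _ heads ⟩
    length heads          ≡⟨ length-map proj₂ K ⟩
    length K              ∎))
    where open ≤-Reasoning

  closure-extensive : ∀ u → u ⊑ closure u
  closure-extensive = rounds-extensive (suc (length K))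

  closure-least : ∀ {u w} → Closed K w → u ⊑ w → closure u ⊑ w
  closure-least = rounds-least (suc (length K))

  roundsNet : ∀ {xs} → ℕ → Net xs → Net xs
  roundsNet t s = fold s (sweepNet K) t

  value-roundsNet : ∀ {xs v u} {s : Net xs} → value v s ≗ u → ∀ t → value v (roundsNet t s) ≗ rounds t u
  value-roundsNet s≗u zero = s≗u
  value-roundsNet {v = v} s≗u (suc t) = value-sweepNet v (value-roundsNet s≗u t) K

  n-roundsNet : ∀ {xs} (s : Net xs) t → Net.n (roundsNet t s) ≡ Net.n s + t * sum (map cost K)
  n-roundsNet s zero = sym (+-identityʳ (Net.n s))
  n-roundsNet s (suc t) = begin
    Net.n (sweepNet K (roundsNet t s))  ≡⟨ n-sweepNet (roundsNet t s) K ⟩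
    Net.n (roundsNet t s) + c           ≡⟨ cong (_+ c) (n-roundsNet s t) ⟩
    Net.n s + t * c + c                 ≡⟨ +-assoc (Net.n s) (t * c) c ⟩
    Net.n s + (t * c + c)               ≡⟨ cong (Net.n s +_) (+-comm (t * c) c) ⟩
    Net.n s + suc t * c                 ∎
    where
    open ≡-Reasoning
    c = sum (map cost K)

  closureNet : (ps : List Atom) → Net ps
  closureNet ps = roundsNet (suc (length K)) (inputNet ps id)

  closureCircuit : List Atom → Atom → Circuit
  closureCircuit ps = readout (closureNet ps)

  eval-closureCircuit : ∀ v ps a → eval v ⟦ closureCircuit ps a ⟧ ≡ closure (restrict v ps) a
  eval-closureCircuit v ps a =
    trans (eval-readout v (closureNet ps) a) (value-roundsNet (value-inputNet v ps id) (suc (length K)) a)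

  circSize-closureCircuit : ∀ ps a → circSize (closureCircuit ps a) ≡ 2 + (length ps + suc (length K) * sum (map cost K))
  circSize-closureCircuit ps a =
    cong (2 +_) (trans (n-roundsNet (inputNet ps id) (suc (length K))) (cong (_+ _) (n-inputNet ps id)))

length-++-≤ : ∀ {A : Set} (xs : List A) {ys m n} → length xs ≤ m → length ys ≤ n → length (xs ++ ys) ≤ suc (m + n)
length-++-≤ xs xs≤m ys≤n = m≤n⇒m≤1+n (subst (_≤ _) (sym (length-++ xs)) (+-mono-≤ xs≤m ys≤n))

length-atoms : ∀ φ → length (atoms φ) ≤ size φ
length-atoms (atom _) = ≤-refl
length-atoms tt = z≤n
length-atoms ff = z≤n
length-atoms (φ & ψ) = length-++-≤ (atoms φ) (length-atoms φ) (length-atoms ψ)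
length-atoms (φ ∣∣ ψ) = length-++-≤ (atoms φ) (length-atoms φ) (length-atoms ψ)
length-atoms (φ ⇒ ψ) = length-++-≤ (atoms φ) (length-atoms φ) (length-atoms ψ)

length-clauses : ∀ {Γ} (hs : All Horn Γ) → length (clauses hs) ≤ sizeL Γ
length-clauses [] = z≤n
length-clauses (atom _ ∷ hs) = s≤s (length-clauses hs)
length-clauses (imp _ _ ∷ hs) = s≤s (≤-trans (length-clauses hs) (m≤n+m _ _))

length≤size-conjAux : ∀ p ps → suc (length ps) ≤ size (conjAux p ps)
length≤size-conjAux p [] = ≤-refl
length≤size-conjAux p (q ∷ qs) = s≤s (≤-trans (length≤size-conjAux q qs) (n≤1+n _))

cost-clause : ∀ {φ} (hφ : Horn φ) → cost (clause hφ) ≤ 2 * size φ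
cost-clause (atom _) = ≤-refl
cost-clause (imp (p ∷ ps) r) = begin
  2 + suc (length ps)            ≤⟨ +-monoʳ-≤ 2 (length≤size-conjAux p ps) ⟩
  2 + size c                     ≡⟨ cong suc (+-comm 1 (size c)) ⟩
  size (c ⇒ atom r)              ≤⟨ m≤m+n _ _ ⟩
  2 * size (c ⇒ atom r)          ∎
  where
  open ≤-Reasoning
  c = conjAux p ps

cost-clauses : ∀ {Γ} (hs : All Horn Γ) → sum (map cost (clauses hs)) ≤ 2 * sizeL Γ
cost-clauses [] = z≤n
cost-clauses {φ ∷ Γ} (hφ ∷ hs) =
  ≤-trans (+-mono-≤ (cost-clause hφ) (cost-clauses hs)) (≤-reflexive (sym (*-distribˡ-+ 2 (size φ) (sizeL Γ))))

quadratic≤quintic : ∀ N → 2 + (N + suc N * (2 * N)) ≤ 5 * N ^ 5 + 5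
quadratic≤quintic zero = s≤s (s≤s z≤n)
quadratic≤quintic N@(suc _) = begin
  2 + (N + suc N * (2 * N))       ≡⟨ expand N ⟩
  2 + 3 * N ^ 1 + 2 * N ^ 2       ≤⟨ +-mono-≤ (+-monoʳ-≤ 2 (*-monoʳ-≤ 3 (^-monoʳ-≤ N 1≤5))) (*-monoʳ-≤ 2 (^-monoʳ-≤ N 2≤5)) ⟩
  2 + 3 * N ^ 5 + 2 * N ^ 5       ≡⟨ collect (N ^ 5) ⟩
  5 * N ^ 5 + 2                   ≤⟨ +-monoʳ-≤ (5 * N ^ 5) (s≤s (s≤s z≤n)) ⟩
  5 * N ^ 5 + 5                   ∎
  where
  open ≤-Reasoning
  expand : ∀ M → 2 + (M + suc M * (2 * M)) ≡ 2 + 3 * (M * 1) + 2 * (M * (M * 1))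
  expand = solve-∀
  collect : ∀ M → 2 + 3 * M + 2 * M ≡ 5 * M + 2
  collect = solve-∀
  1≤5 : 1 ≤ 5
  1≤5 = s≤s z≤n
  2≤5 : 2 ≤ 5
  2≤5 = s≤s (s≤s z≤n)

module _ {Γ : List Fm} (hs : All Horn Γ) where
  open ForwardChaining (clauses hs)

  closureCircuit-sound : ∀ ps a → Valid (⟦ closureCircuit ps a ⟧ ∷ Γ) (atom a ∷ [])
  closureCircuit-sound ps a = valid⁺ {⟦ closureCircuit ps a ⟧ ∷ Γ} {atom a ∷ []} λ where
    v (v⊨C ∷ v⊨Γ) →
      here (closure-least (models⇒closed hs v⊨Γ) (restrict-⊑ v ps) (subst T (eval-closureCircuit v ps a) v⊨C))

  closureCircuit-cover : ∀ {φ q r} → Monotone φ → Valid (φ ∷ Γ) (atom q ∷ atom r ∷ []) →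
    Valid (φ ∷ Γ) (⟦ closureCircuit (atoms φ) q ⟧ ∷ ⟦ closureCircuit (atoms φ) r ⟧ ∷ [])
  closureCircuit-cover {φ} {q} {r} mφ valid = valid⁺ {φ ∷ Γ} {map (⟦_⟧ ∘ C) (q ∷ r ∷ [])} entails
    where
    C = closureCircuit (atoms φ)
    entails : ∀ v → All (T ∘ eval v) (φ ∷ Γ) → Any (T ∘ eval v) (map (⟦_⟧ ∘ C) (q ∷ r ∷ []))
    entails v (v⊨φ ∷ _) =
      map⁺ {f = ⟦_⟧ ∘ C} (Any.map (subst T (sym (eval-closureCircuit v (atoms φ) _))) (map⁻ {f = atom} w⊨q∨r))
      where
      w = closure (restrict v (atoms φ))
      w⊨φ : T (eval w φ)
      w⊨φ = eval-mono mφ (λ x∈ → closure-extensive _ ∘ restrict-∈ x∈) v⊨φ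
      w⊨q∨r : Any (T ∘ eval w) (map atom (q ∷ r ∷ []))
      w⊨q∨r = valid⁻ {φ ∷ Γ} valid w (w⊨φ ∷ closed⇒models hs (closure-closed _))

  circSize-closureCircuit-≤ : ∀ φ a → circSize (closureCircuit (atoms φ) a) ≤ 5 * (sizeL Γ + size φ) ^ 5 + 5
  circSize-closureCircuit-≤ φ a = begin
    circSize (closureCircuit (atoms φ) a)              ≡⟨ circSize-closureCircuit (atoms φ) a ⟩
    2 + (length (atoms φ) + suc (length K) * sum (map cost K))
      ≤⟨ +-monoʳ-≤ 2 (+-mono-≤ (≤-trans (length-atoms φ) (m≤n+m (size φ) (sizeL Γ)))
                                (*-mono-≤ (s≤s (≤-trans (length-clauses hs) Γ≤N))
                                          (≤-trans (cost-clauses hs) (*-monoʳ-≤ 2 Γ≤N)))) ⟩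
    2 + (N + suc N * (2 * N))                          ≤⟨ quadratic≤quintic N ⟩
    5 * N ^ 5 + 5                                      ∎
    where
    open ≤-Reasoning
    K = clauses hs
    N = sizeL Γ + size φ
    Γ≤N : sizeL Γ ≤ N
    Γ≤N = m≤m+n (sizeL Γ) (size φ)

theorem7p7 : Σ ℕ λ c → (Γ : List Fm) → All Horn Γ → (φ : Fm) → Monotone φ →
    (q r : Atom) → Valid (φ ∷ Γ) (atom q ∷ atom r ∷ []) →
    Σ Circuit λ C → Σ Circuit λ D →
      CircuitIn φ C × CircuitIn φ D ×
      circSize C ≤ c * (sizeL Γ + size φ) ^ c + c ×
      circSize D ≤ c * (sizeL Γ + size φ) ^ c + c ×
      Valid (φ ∷ Γ) (⟦ C ⟧ ∷ ⟦ D ⟧ ∷ []) ×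
      Valid (⟦ C ⟧ ∷ Γ) (atom q ∷ []) ×
      Valid (⟦ D ⟧ ∷ Γ) (atom r ∷ [])
theorem7p7 = 5 , λ Γ hs φ mφ q r valid →
  let open ForwardChaining (clauses hs)
      inputsIn = inputs (closureNet (atoms φ))
  in closureCircuit (atoms φ) q , closureCircuit (atoms φ) r ,
     inputsIn , inputsIn ,
     circSize-closureCircuit-≤ hs φ q , circSize-closureCircuit-≤ hs φ r ,
     closureCircuit-cover hs mφ valid ,
     closureCircuit-sound hs (atoms φ) q , closureCircuit-sound hs (atoms φ) r
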